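{- Let $1 \leq t \leq k$ and $m \geq 2k-t$ be integers. Let $\mathcal F$ be a $t$-intersecting family of $k$-multisets of $[m]$. Let $T \in \mathcal K(\mathcal F)$ and let $i \in [m]$ with $i \in T_{>1}$, and set $s = \mathrm{m}(i,T)$. Define \[\widehat{\mathcal F} = \mathcal S_{(i,s)(m)}\Big[\mathcal S_{(i,s)(m-1)}\big[\cdots\big[\mathcal S_{(i,s)(1)}(\mathcal F)\big]\cdots\big]\Big].\] If $\widehat{\mathcal F}$ is isomorphic to $\mathcal F_{(r)}$ for some $r>0$, then so is $\mathcal F$.
   Context: A $k$-multiset of $[m]=\{1,\dots,m\}$ is a multiset of cardinality $k$ (counting repetitions) with elements from $[m]$; $\mathrm{m}(i,A)$ is the multiplicity of $i$ in $A$. The intersection $A\cap B$ of multisets has multiplicities $\min\{\mathrm{m}(i,A),\mathrm{m}(i,B)\}$; sets are multisets with all multiplicities one. A family is $t$-intersecting if $|A\cap B|\ge t$ for all members $A,B$. A multiset $T$ (elements from $[m]$, any size) is a $t$-kernel for $\mathcal F$ if $|F_1\cap F_2\cap T|\ge t$ for all $F_1,F_2\in\mathcal F$; $\mathcal K(\mathcal F)$ is the set of $t$-kernels $T$ for $\mathcal F$ with $[m]\subseteq T$ (every element of $[m]$ has multiplicity at least 1 in $T$). $T_{>1}$ is the multiset difference $T\setminus[m]$, so $i\in T_{>1}$ means $\mathrm{m}(i,T)\ge 2$. For a multiset $F$, $s\ge 1$ and $j\in[m]$: if $s\le \mathrm{m}(i,F)$ and $j\notin F$, $F_{(i,s)(j)}$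 is the multiset obtained from $F$ by replacing all but $s-1$ copies of $i$ by copies of $j$ (so $i$ has multiplicity $s-1$, $j$ has multiplicity $\mathrm{m}(i,F)-s+1$, others unchanged); if $s>\mathrm{m}(i,F)$, $F_{(i,s)(j)}=F$. For a family $\mathcal F$, $\mathcal S_{(i,s)(j)}(\mathcal F)=\{\mathcal S_{(i,s)(j)}(F): F\in\mathcal F\}$, where $\mathcal S_{(i,s)(j)}(F)=F_{(i,s)(j)}$ if $j\notin F$ and $F_{(i,s)(j)}\notin\mathcal F$, and $\mathcal S_{(i,s)(j)}(F)=F$ otherwise. For $r\ge0$, $\mathcal F_{(r)}=\{G \text{ a } k\text{ -multiset of } [m]: |G\cap[t+2r]|\ge t+r\}$. Families are isomorphic if one is obtained from the other by a permutation of $[m]$. -}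

module Defs where

open import Data.Nat using (ℕ; zero; suc; _+_; _∸_; _≤_; _≤?_; _<ᵇ_; _⊓_)
open import Data.Bool using (if_then_else_)
open import Data.Fin using (Fin; toℕ)
open import Data.Fin.Permutation using (Permutation′; _⟨$⟩ʳ_)
open import Data.Vec using (Vec; lookup; tabulate; zipWith; sum; _[_]≔_)
open import Data.List using (List; foldl; allFin)
open import Data.Product using (Σ; ∃; _×_)
open import Data.Sum using (_⊎_)
open import Relation.Nullary using (¬_; does)
open import Relation.Binary.PropositionalEquality using (_≡_)
open import Function.Bundles using (_⇔_)

-- A multiset with elements from [m] = Fin m is its multiplicity vector.
MSet : ℕ → Set
MSet m = Vec ℕ m

mult : ∀ {m} → Fin m → MSet m → ℕ
mult i A = lookup A i

card : ∀ {m} → MSet m → ℕ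
card A = sum A

_∩_ : ∀ {m} → MSet m → MSet m → MSet m
A ∩ B = zipWith _⊓_ A B

infixl 7 _∩_

-- the set [n] ∩ [m] = {x : toℕ x < n} (elements 0-indexed: Fin m element x is x+1)
upTo : ∀ m → ℕ → MSet m
upTo m n = tabulate (λ x → if toℕ x <ᵇ n then 1 else 0)

fullSet : ∀ m → MSet m
fullSet m = tabulate (λ _ → 1)

Family : ℕ → Set₁
Family m = MSet m → Set

IsKFamily : ∀ {m} → ℕ → Family m → Set
IsKFamily k 𝓕 = ∀ F → 𝓕 F → card F ≡ k

IsTIntersecting : ∀ {m} → ℕ → Family m → Set
IsTIntersecting t 𝓕 = ∀ A B → 𝓕 A → 𝓕 B → t ≤ card (A ∩ B)

IsKernel : ∀ {m} → ℕ → Family m → MSet m → Set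
IsKernel t 𝓕 T = ∀ F₁ F₂ → 𝓕 F₁ → 𝓕 F₂ → t ≤ card (F₁ ∩ F₂ ∩ T)

-- T ∈ 𝓚(𝓕): t-kernel with [m] ⊆ T
InK : ∀ {m} → ℕ → Family m → MSet m → Set
InK t 𝓕 T = IsKernel t 𝓕 T × (∀ x → 1 ≤ mult x T)

_∈ₘ_ : ∀ {m} → Fin m → MSet m → Set
j ∈ₘ F = 1 ≤ mult j F

-- F_{(i,s)(j)} (meaningful for j ∉ F, where mult j F = 0):
-- if s ≤ m(i,F): i gets multiplicity s-1, j gets m(i,F)-s+1; otherwise F.
shiftMS : ∀ {m} → MSet m → Fin m → ℕ → Fin m → MSet m
shiftMS F i s j =
  if does (s ≤? mult i F)
  then ((F [ i ]≔ (s ∸ 1)) [ j ]≔ (mult j F + (mult i F ∸ (s ∸ 1))))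
  else F

-- G = S_{(i,s)(j)}(F) relative to the family 𝓕
ShiftsTo : ∀ {m} → Family m → Fin m → ℕ → Fin m → MSet m → MSet m → Set
ShiftsTo 𝓕 i s j F G =
  ((j ∈ₘ F ⊎ 𝓕 (shiftMS F i s j)) × G ≡ F)
  ⊎ ((¬ (j ∈ₘ F) × ¬ 𝓕 (shiftMS F i s j)) × G ≡ shiftMS F i s j)

shiftFam : ∀ {m} → Fin m → ℕ → Fin m → Family m → Family m
shiftFam i s j 𝓕 G = ∃ λ F → 𝓕 F × ShiftsTo 𝓕 i s j F G

-- S_{(i,s)(m)}[ ... S_{(i,s)(1)}(𝓕) ... ]  (j runs through [m] in increasing order)
shiftAll : ∀ {m} → Fin m → ℕ → Family m → Family m
shiftAll {m} i s 𝓕 = foldl (λ 𝓖 j → shiftFam i s j 𝓖) 𝓕 (allFin m)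

famR : ∀ m → ℕ → ℕ → ℕ → Family m
famR m k t r G = card G ≡ k × t + r ≤ card (G ∩ upTo m (t + 2 * r))
  where open import Data.Nat using (_*_)

permute : ∀ {m} → Permutation′ m → MSet m → MSet m
permute σ G = tabulate (λ x → lookup G (σ ⟨$⟩ʳ x))

Isomorphic : ∀ {m} → Family m → Family m → Set
Isomorphic {m} 𝓐 𝓑 = ∃ λ (σ : Permutation′ m) → ∀ G → 𝓐 G ⇔ 𝓑 (permute σ G)

-- Put P G := (σ·G ∈ 𝓕_(r)), so that P is the shifted family. Shifting towards i only
-- ever produces multisets in which i has multiplicity s − 1, so every member of the
-- shifted family in which i has any other multiplicity already lies in 𝓕; as s ≥ 2,
-- this applies to all members of P avoiding i. If some F ∈ 𝓕 were outside P, then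
-- m(i,F) ≥ s (otherwise the shifts leave F alone) and F meets the block [t+2r] in
-- fewer than t + r points; so that block, with i removed, contains at least r + 1
-- points outside F, and a member H of P avoiding i can be built that meets F in at
-- most t − 1 points. Then H ∈ 𝓕 contradicts t-intersection. Hence 𝓕 ⊆ P; then every
-- member of 𝓕 survives all the shifts, so none of them was moved and P ⊆ 𝓕.
module Submission where

open import Defs
open import Data.Nat using (ℕ; zero; suc; _+_; _*_; _∸_; _≤_; _<_; _≰_; _⊓_; z≤n; s≤s; s≤s⁻¹; _≤?_; _≟_)
open import Data.Nat.Properties
open import Data.Nat.Tactic.RingSolver using (solve-∀)
open import Data.Fin using (Fin; zero; suc) renaming (_≟_ to _≟ᶠ_)
open import Data.Fin.Permutation using (Permutation′; _⟨$⟩ʳ_; flip; inverseˡ; inverseʳ)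
open import Data.Vec using (Vec; []; _∷_; lookup; sum; _[_]≔_)
open import Data.Vec.Properties
  using (lookup∘tabulate; tabulate∘lookup; tabulate-cong; lookup-zipWith; lookup∘update; lookup∘update′)
open import Data.List using (List; []; _∷_; foldl; allFin)
open import Data.Product using (_×_; _,_; proj₁; proj₂; ∃)
open import Data.Sum using (_⊎_; inj₁; inj₂; [_,_]′)
open import Data.Empty using (⊥; ⊥-elim)
open import Relation.Nullary using (¬_; yes; no; Dec)
open import Relation.Nullary.Decidable using (_×-dec_; dec-true; dec-false; decidable-stable)
open import Relation.Binary.PropositionalEquality
open import Function.Base using (_∘_)
open import Function.Bundles using (_⇔_; mk⇔; Equivalence)
import Algebra.Properties.CommutativeMonoid.Sum as CommutativeMonoidSum

private
  variable
    n : ℕ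

vec-ext : {xs ys : Vec ℕ n} → (∀ x → lookup xs x ≡ lookup ys x) → xs ≡ ys
vec-ext {xs = xs} {ys} eq = trans (sym (tabulate∘lookup xs)) (trans (tabulate-cong eq) (tabulate∘lookup ys))

card-∩-≤ˡ : (A B : MSet n) → card (A ∩ B) ≤ card A
card-∩-≤ˡ [] [] = z≤n
card-∩-≤ˡ (a ∷ A) (b ∷ B) = +-mono-≤ (m⊓n≤m a b) (card-∩-≤ˡ A B)

card-∩-update-0 : ∀ (A B : MSet n) p → card (A ∩ (B [ p ]≔ 0)) ≤ card (A ∩ B)
card-∩-update-0 (a ∷ A) (b ∷ B) zero rewrite ⊓-zeroʳ a = m≤n+m _ _
card-∩-update-0 (a ∷ A) (b ∷ B) (suc p) = +-monoʳ-≤ (a ⊓ b) (card-∩-update-0 A B p)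

nonzeros : MSet n → ℕ
nonzeros [] = 0
nonzeros (zero ∷ u) = nonzeros u
nonzeros (suc _ ∷ u) = suc (nonzeros u)

zeros_on_ : MSet n → MSet n → ℕ
zeros [] on [] = 0
zeros (_ ∷ f) on (zero ∷ u) = zeros f on u
zeros (zero ∷ f) on (suc _ ∷ u) = suc (zeros f on u)
zeros (suc _ ∷ f) on (suc _ ∷ u) = zeros f on u

positives_on_ : MSet n → MSet n → ℕ
positives [] on [] = 0
positives (_ ∷ f) on (zero ∷ u) = positives f on u
positives (zero ∷ f) on (suc _ ∷ u) = positives f on u
positives (suc _ ∷ f) on (suc _ ∷ u) = suc (positives f on u)

infix 10 zeros_on_ positives_on_

zeros+positives : (f u : MSet n) → zeros f on u + positives f on u ≡ nonzeros u
zeros+positives [] [] = refl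
zeros+positives (_ ∷ f) (zero ∷ u) = zeros+positives f u
zeros+positives (zero ∷ f) (suc _ ∷ u) = cong suc (zeros+positives f u)
zeros+positives (suc _ ∷ f) (suc _ ∷ u) = trans (+-suc _ _) (cong suc (zeros+positives f u))

positives≤card-∩ : (f u : MSet n) → positives f on u ≤ card (f ∩ u)
positives≤card-∩ [] [] = z≤n
positives≤card-∩ (a ∷ f) (zero ∷ u) = ≤-trans (positives≤card-∩ f u) (m≤n+m _ _)
positives≤card-∩ (zero ∷ f) (suc _ ∷ u) = positives≤card-∩ f u
positives≤card-∩ (suc _ ∷ f) (suc _ ∷ u) = s≤s (≤-trans (positives≤card-∩ f u) (m≤n+m _ _))

nonzeros<zeros+card-∩ : ∀ (f u : MSet n) {c} → card (f ∩ u) < c → nonzeros u < zeros f on u + c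
nonzeros<zeros+card-∩ f u {c} f∩u<c = begin-strict
  nonzeros u                         ≡⟨ zeros+positives f u ⟨
  zeros f on u + positives f on u    <⟨ +-monoʳ-< (zeros f on u) (≤-<-trans (positives≤card-∩ f u) f∩u<c) ⟩
  zeros f on u + c                   ∎
  where open ≤-Reasoning

zeros-update-0 : ∀ (f u : MSet n) p → 1 ≤ mult p f → zeros f on (u [ p ]≔ 0) ≡ zeros f on u
zeros-update-0 (suc _ ∷ f) (zero ∷ u) zero _ = refl
zeros-update-0 (suc _ ∷ f) (suc _ ∷ u) zero _ = refl
zeros-update-0 (_ ∷ f) (zero ∷ u) (suc p) fp = zeros-update-0 f u p fp
zeros-update-0 (zero ∷ f) (suc _ ∷ u) (suc p) fp = cong suc (zeros-update-0 f u p fp)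
zeros-update-0 (suc _ ∷ f) (suc _ ∷ u) (suc p) fp = zeros-update-0 f u p fp

nonzeros-update-0 : ∀ (u : MSet n) p → nonzeros u ≤ suc (nonzeros (u [ p ]≔ 0))
nonzeros-update-0 (zero ∷ u) zero = n≤1+n _
nonzeros-update-0 (suc _ ∷ u) zero = ≤-refl
nonzeros-update-0 (zero ∷ u) (suc p) = nonzeros-update-0 u p
nonzeros-update-0 (suc _ ∷ u) (suc p) = s≤s (nonzeros-update-0 u p)

nonzeros-upTo : ∀ m N → nonzeros (upTo m N) ≡ N ⊓ m
nonzeros-upTo zero N = sym (⊓-zeroʳ N)
nonzeros-upTo (suc m) zero = nonzeros-upTo m zero
nonzeros-upTo (suc m) (suc N) = cong suc (nonzeros-upTo m N)

-- Inside supp u, take up to a points where f vanishes (the first of them with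
-- multiplicity 1 + e) and up to b points where f is positive.
pick : MSet n → MSet n → ℕ → ℕ → ℕ → MSet n
pick [] [] a b e = []
pick (_ ∷ f) (zero ∷ u) a b e = 0 ∷ pick f u a b e
pick (zero ∷ f) (suc _ ∷ u) zero b e = 0 ∷ pick f u zero b e
pick (zero ∷ f) (suc _ ∷ u) (suc a) b e = suc e ∷ pick f u a b 0
pick (suc _ ∷ f) (suc _ ∷ u) a zero e = 0 ∷ pick f u a zero e
pick (suc _ ∷ f) (suc _ ∷ u) a (suc b) e = 1 ∷ pick f u a b e

card-pick : ∀ (f u : MSet n) a b e → e ≡ 0 ⊎ (1 ≤ a × 1 ≤ zeros f on u) →
  card (pick f u a b e) ≡ a ⊓ zeros f on u + b ⊓ positives f on u + e
card-pick [] [] a b e (inj₁ refl) rewrite ⊓-zeroʳ a | ⊓-zeroʳ b = refl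
card-pick [] [] a b e (inj₂ (_ , ()))
card-pick (_ ∷ f) (zero ∷ u) a b e h = card-pick f u a b e h
card-pick (zero ∷ f) (suc _ ∷ u) zero b e (inj₁ refl) = card-pick f u zero b 0 (inj₁ refl)
card-pick (zero ∷ f) (suc _ ∷ u) (suc a) b e h =
  trans (cong (suc e +_) (card-pick f u a b 0 (inj₁ refl))) (move e (a ⊓ zeros f on u) (b ⊓ positives f on u))
  where
  move : ∀ e x y → suc e + (x + y + 0) ≡ suc x + y + e
  move = solve-∀
card-pick (suc _ ∷ f) (suc _ ∷ u) a zero e h = card-pick f u a zero e h
card-pick (suc _ ∷ f) (suc _ ∷ u) a (suc b) e h =
  trans (cong suc (card-pick f u a b e h)) (move (a ⊓ zeros f on u) (b ⊓ positives f on u) e)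
  where
  move : ∀ x y e → suc (x + y + e) ≡ x + suc y + e
  move = solve-∀

card-pick-∩ : ∀ (f u : MSet n) a b e →
  a ⊓ zeros f on u + b ⊓ positives f on u ≤ card (pick f u a b e ∩ u)
card-pick-∩ [] [] a b e rewrite ⊓-zeroʳ a | ⊓-zeroʳ b = z≤n
card-pick-∩ (_ ∷ f) (zero ∷ u) a b e = card-pick-∩ f u a b e
card-pick-∩ (zero ∷ f) (suc _ ∷ u) zero b e = card-pick-∩ f u zero b e
card-pick-∩ (zero ∷ f) (suc _ ∷ u) (suc a) b e = s≤s (≤-trans (card-pick-∩ f u a b 0) (m≤n+m _ _))
card-pick-∩ (suc _ ∷ f) (suc _ ∷ u) a zero e = card-pick-∩ f u a zero e
card-pick-∩ (suc _ ∷ f) (suc _ ∷ u) a (suc b) e =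
  subst (_≤ suc (card (pick f u a b e ∩ u))) (sym (+-suc _ _)) (s≤s (card-pick-∩ f u a b e))

card-∩-pick : ∀ (f u : MSet n) a b e → card (f ∩ pick f u a b e) ≤ b ⊓ positives f on u
card-∩-pick [] [] a b e = z≤n
card-∩-pick (c ∷ f) (zero ∷ u) a b e rewrite ⊓-zeroʳ c = card-∩-pick f u a b e
card-∩-pick (zero ∷ f) (suc _ ∷ u) zero b e = card-∩-pick f u zero b e
card-∩-pick (zero ∷ f) (suc _ ∷ u) (suc a) b e = card-∩-pick f u a b 0
card-∩-pick (suc _ ∷ f) (suc _ ∷ u) a zero e = card-∩-pick f u a zero e
card-∩-pick (suc c ∷ f) (suc _ ∷ u) a (suc b) e rewrite ⊓-zeroʳ c = s≤s (card-∩-pick f u a b e)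

pick-outside : ∀ (f u : MSet n) a b e p → mult p u ≡ 0 → mult p (pick f u a b e) ≡ 0
pick-outside (_ ∷ f) (zero ∷ u) a b e zero _ = refl
pick-outside (_ ∷ f) (zero ∷ u) a b e (suc p) up = pick-outside f u a b e p up
pick-outside (zero ∷ f) (suc _ ∷ u) zero b e (suc p) up = pick-outside f u zero b e p up
pick-outside (zero ∷ f) (suc _ ∷ u) (suc a) b e (suc p) up = pick-outside f u a b 0 p up
pick-outside (suc _ ∷ f) (suc _ ∷ u) a zero e (suc p) up = pick-outside f u a zero e p up
pick-outside (suc _ ∷ f) (suc _ ∷ u) a (suc b) e (suc p) up = pick-outside f u a b e p up

-- Removing p, a point of f, from supp u leaves more than r points of supp u outside f
-- and at least t + r points in all; pick t + r of them, at most t − 1 inside f.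
avoiding-multiset : ∀ {k t r} (f u : MSet n) p → 1 ≤ t → 0 < r → t + r ≤ k →
  t + 2 * r ≤ nonzeros u → card (f ∩ u) < t + r → 1 ≤ mult p f →
  ∃ λ h → (card h ≡ k × t + r ≤ card (h ∩ u)) × mult p h ≡ 0 × card (f ∩ h) < t
avoiding-multiset {k = k} {t} {r} f u p 1≤t 0<r t+r≤k t+2r≤u f∩u<t+r 1≤fp =
  h , (card-h , t+r≤h∩u) , pick-outside f u′ a (t ∸ 1) e p (lookup∘update p u 0) , f∩h<t
  where
  u′ = u [ p ]≔ 0
  z = zeros f on u′
  q = positives f on u′
  x = (t ∸ 1) ⊓ q
  a = (t + r) ∸ x
  e = k ∸ (t + r)
  h = pick f u′ a (t ∸ 1) e
  open ≤-Reasoning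

  x<t : x < t
  x<t = ≤-<-trans (m⊓n≤m _ q) (∸-monoʳ-< (s≤s z≤n) 1≤t)

  x<t+r : x < t + r
  x<t+r = <-≤-trans x<t (m≤m+n t r)

  r<z : r < z
  r<z = +-cancelʳ-< (t + r) r z (begin-strict
    r + (t + r)          ≡⟨ regroup t r ⟩
    t + 2 * r            ≤⟨ t+2r≤u ⟩
    nonzeros u           <⟨ nonzeros<zeros+card-∩ f u f∩u<t+r ⟩
    zeros f on u + (t + r) ≡⟨ cong (_+ (t + r)) (zeros-update-0 f u p 1≤fp) ⟨
    z + (t + r)          ∎)
    where
    regroup : ∀ t r → r + (t + r) ≡ t + 2 * r
    regroup = solve-∀

  t+r≤z+q : t + r ≤ z + q
  t+r≤z+q = s≤s⁻¹ (begin
    suc (t + r)          ≡⟨ +-suc t r ⟨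
    t + suc r            ≤⟨ +-monoʳ-≤ t (+-monoˡ-≤ r 0<r) ⟩
    t + (r + r)          ≡⟨ regroup t r ⟩
    t + 2 * r            ≤⟨ t+2r≤u ⟩
    nonzeros u           ≤⟨ nonzeros-update-0 u p ⟩
    suc (nonzeros u′)    ≡⟨ cong suc (zeros+positives f u′) ⟨
    suc (z + q)          ∎)
    where
    regroup : ∀ t r → t + (r + r) ≡ t + 2 * r
    regroup = solve-∀

  t+r≤z+t∸1 : t + r ≤ z + (t ∸ 1)
  t+r≤z+t∸1 = begin
    t + r                ≤⟨ +-monoˡ-≤ r (m≤n+m∸n t 1) ⟩
    suc (t ∸ 1) + r      ≡⟨ +-suc (t ∸ 1) r ⟨
    (t ∸ 1) + suc r      ≤⟨ +-monoʳ-≤ (t ∸ 1) r<z ⟩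
    (t ∸ 1) + z          ≡⟨ +-comm (t ∸ 1) z ⟩
    z + (t ∸ 1)          ∎

  a≤z : a ≤ z
  a≤z = m≤n+o⇒m∸n≤o (t + r) x (subst (t + r ≤_) (+-comm z x)
          (subst (t + r ≤_) (sym (+-distribˡ-⊓ z (t ∸ 1) q)) (⊓-glb t+r≤z+t∸1 t+r≤z+q)))

  a⊓z+x≡t+r : a ⊓ z + x ≡ t + r
  a⊓z+x≡t+r = trans (cong (_+ x) (m≤n⇒m⊓n≡m a≤z)) (m∸n+n≡m (<⇒≤ x<t+r))

  card-h : card h ≡ k
  card-h = begin-equality
    card h               ≡⟨ card-pick f u′ a (t ∸ 1) e (inj₂ (m<n⇒0<n∸m x<t+r , ≤-<-trans z≤n r<z)) ⟩
    a ⊓ z + x + e        ≡⟨ cong (_+ e) a⊓z+x≡t+r ⟩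
    t + r + e            ≡⟨ m+[n∸m]≡n t+r≤k ⟩
    k                    ∎

  t+r≤h∩u : t + r ≤ card (h ∩ u)
  t+r≤h∩u = begin
    t + r                ≡⟨ a⊓z+x≡t+r ⟨
    a ⊓ z + x            ≤⟨ card-pick-∩ f u′ a (t ∸ 1) e ⟩
    card (h ∩ u′)        ≤⟨ card-∩-update-0 h u p ⟩
    card (h ∩ u)         ∎

  f∩h<t : card (f ∩ h) < t
  f∩h<t = ≤-<-trans (card-∩-pick f u′ a (t ∸ 1) e) x<t

famR? : ∀ {m} k t r (G : MSet m) → Dec (famR m k t r G)
famR? {m} k t r G = card G ≟ k ×-dec t + r ≤? card (G ∩ upTo m (t + 2 * r))

famR⇒t+r≤k : ∀ {m} k t r (G : MSet m) → famR m k t r G → t + r ≤ k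
famR⇒t+r≤k k t r G (card-G , t+r≤G∩U) = ≤-trans t+r≤G∩U (subst (_ ≤_) card-G (card-∩-≤ˡ G _))

famR-avoiding : ∀ {m k t r} (f : MSet m) p → 1 ≤ t → 0 < r → t + r ≤ k → t + 2 * r ≤ m →
  card f ≡ k → ¬ famR m k t r f → 1 ≤ mult p f →
  ∃ λ h → famR m k t r h × mult p h ≡ 0 × card (f ∩ h) < t
famR-avoiding {m} {k} {t} {r} f p 1≤t 0<r t+r≤k t+2r≤m card-f f∉ =
  avoiding-multiset f (upTo m (t + 2 * r)) p 1≤t 0<r t+r≤k t+2r≤U f∩U<t+r
  where
  t+2r≤U : t + 2 * r ≤ nonzeros (upTo m (t + 2 * r))
  t+2r≤U = ≤-reflexive (sym (trans (nonzeros-upTo m (t + 2 * r)) (m≤n⇒m⊓n≡m t+2r≤m)))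
  f∩U<t+r : card (f ∩ upTo m (t + 2 * r)) < t + r
  f∩U<t+r = ≰⇒> (λ t+r≤f∩U → f∉ (card-f , t+r≤f∩U))

open CommutativeMonoidSum +-0-commutativeMonoid using (sum-permute; sum-cong-≗) renaming (sum to ∑)

sum≡∑lookup : (xs : Vec ℕ n) → sum xs ≡ ∑ (lookup xs)
sum≡∑lookup [] = refl
sum≡∑lookup (x ∷ xs) = cong (x +_) (sum≡∑lookup xs)

card-permute : (σ : Permutation′ n) (G : MSet n) → card (permute σ G) ≡ card G
card-permute σ G = begin
  card (permute σ G)               ≡⟨ sum≡∑lookup (permute σ G) ⟩
  ∑ (lookup (permute σ G))         ≡⟨ sum-cong-≗ (lookup∘tabulate (λ x → lookup G (σ ⟨$⟩ʳ x))) ⟩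
  ∑ (λ x → lookup G (σ ⟨$⟩ʳ x))    ≡⟨ sum-permute (lookup G) σ ⟨
  ∑ (lookup G)                     ≡⟨ sum≡∑lookup G ⟨
  card G                           ∎
  where open ≡-Reasoning

permute-∩ : (σ : Permutation′ n) (A B : MSet n) → permute σ (A ∩ B) ≡ permute σ A ∩ permute σ B
permute-∩ σ A B = vec-ext λ x → begin
  lookup (permute σ (A ∩ B)) x                      ≡⟨ lookup∘tabulate _ x ⟩
  lookup (A ∩ B) (σ ⟨$⟩ʳ x)                         ≡⟨ lookup-zipWith _⊓_ (σ ⟨$⟩ʳ x) A B ⟩
  lookup A (σ ⟨$⟩ʳ x) ⊓ lookup B (σ ⟨$⟩ʳ x)         ≡⟨ cong₂ _⊓_ (lookup∘tabulate _ x) (lookup∘tabulate _ x) ⟨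
  lookup (permute σ A) x ⊓ lookup (permute σ B) x   ≡⟨ lookup-zipWith _⊓_ x (permute σ A) (permute σ B) ⟨
  lookup (permute σ A ∩ permute σ B) x              ∎
  where open ≡-Reasoning

card-∩-permute : (σ : Permutation′ n) (A B : MSet n) → card (permute σ A ∩ permute σ B) ≡ card (A ∩ B)
card-∩-permute σ A B = trans (cong card (sym (permute-∩ σ A B))) (card-permute σ (A ∩ B))

permute-flip : (σ : Permutation′ n) (H : MSet n) → permute σ (permute (flip σ) H) ≡ H
permute-flip σ H = vec-ext λ x →
  trans (lookup∘tabulate _ x) (trans (lookup∘tabulate _ (σ ⟨$⟩ʳ x)) (cong (lookup H) (inverseˡ σ)))

famR∘permute-avoiding : ∀ {m k t r} (σ : Permutation′ m) (F : MSet m) i → 1 ≤ t → 0 < r → t + r ≤ k →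
  t + 2 * r ≤ m → card F ≡ k → ¬ famR m k t r (permute σ F) → 1 ≤ mult i F →
  ∃ λ H → famR m k t r (permute σ H) × mult i H ≡ 0 × card (F ∩ H) < t
famR∘permute-avoiding {m} {k} {t} {r} σ F i 1≤t 0<r t+r≤k t+2r≤m card-F σF∉ 1≤Fi =
  let h , h∈ , hp≡0 , σF∩h<t = famR-avoiding (permute σ F) p 1≤t 0<r t+r≤k t+2r≤m
                                 (trans (card-permute σ F) card-F) σF∉ 1≤σFp
      H = permute (flip σ) h
      σH≡h = permute-flip σ h
  in H , subst (famR m k t r) (sym σH≡h) h∈ , trans (lookup∘tabulate _ i) hp≡0 ,
     subst (_< t) (trans (cong (λ X → card (permute σ F ∩ X)) (sym σH≡h)) (card-∩-permute σ F H)) σF∩h<t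
  where
  p = flip σ ⟨$⟩ʳ i
  1≤σFp : 1 ≤ mult p (permute σ F)
  1≤σFp = subst (1 ≤_) (sym (trans (lookup∘tabulate _ p) (cong (lookup F) (inverseʳ σ)))) 1≤Fi

shiftMS-≰ : ∀ {m} (F : MSet m) i s j → s ≰ mult i F → shiftMS F i s j ≡ F
shiftMS-≰ F i s j s≰F rewrite dec-false (s ≤? mult i F) s≰F = refl

mult-shiftMS : ∀ {m} (F : MSet m) i s j → j ≢ i → s ≤ mult i F → mult i (shiftMS F i s j) ≡ s ∸ 1
mult-shiftMS F i s j j≢i s≤F rewrite dec-true (s ≤? mult i F) s≤F =
  trans (lookup∘update′ (j≢i ∘ sym) (F [ i ]≔ (s ∸ 1)) _) (lookup∘update i F (s ∸ 1))

module Shifting {m} (i : Fin m) (s : ℕ) (1≤s : 1 ≤ s) where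

  shifts : List (Fin m) → Family m → Family m
  shifts js 𝓖 = foldl (λ 𝓗 j → shiftFam i s j 𝓗) 𝓖 js

  s≤⇒≢s∸1 : ∀ {x} → s ≤ x → x ≢ s ∸ 1
  s≤⇒≢s∸1 s≤x x≡s∸1 = <⇒≢ (<-≤-trans (∸-monoʳ-< (s≤s z≤n) 1≤s) s≤x) (sym x≡s∸1)

  -- Every multiset that the shift actually moves ends up with i of multiplicity s − 1.
  shiftFam-unmoved : ∀ {j 𝓖 H} → shiftFam i s j 𝓖 H → mult i H ≢ s ∸ 1 →
    𝓖 H × (j ∈ₘ H ⊎ 𝓖 (shiftMS H i s j))
  shiftFam-unmoved (K , 𝓖K , inj₁ (blocked , refl)) _ = 𝓖K , blocked
  shiftFam-unmoved {j} {𝓖} (K , 𝓖K , inj₂ ((j∉K , moved∉𝓖) , refl)) iH≢s∸1 with s ≤? mult i K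
  ... | no s≰K = ⊥-elim (moved∉𝓖 (subst 𝓖 (sym (shiftMS-≰ K i s j s≰K)) 𝓖K))
  ... | yes s≤K with j ≟ᶠ i
  ...   | yes refl = ⊥-elim (j∉K (≤-trans 1≤s s≤K))
  ...   | no j≢i = ⊥-elim (iH≢s∸1 (mult-shiftMS K i s j j≢i s≤K))

  shifts-unmoved : ∀ js 𝓖 H → shifts js 𝓖 H → mult i H ≢ s ∸ 1 → 𝓖 H
  shifts-unmoved [] 𝓖 H H∈ _ = H∈
  shifts-unmoved (j ∷ js) 𝓖 H H∈ iH≢s∸1 =
    proj₁ (shiftFam-unmoved (shifts-unmoved js (shiftFam i s j 𝓖) H H∈ iH≢s∸1) iH≢s∸1)

  shifts-keep-≱ : ∀ js 𝓖 F → 𝓖 F → s ≰ mult i F → shifts js 𝓖 F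
  shifts-keep-≱ [] 𝓖 F 𝓖F _ = 𝓖F
  shifts-keep-≱ (j ∷ js) 𝓖 F 𝓖F s≰F =
    shifts-keep-≱ js (shiftFam i s j 𝓖) F (F , 𝓖F , inj₁ (inj₂ (subst 𝓖 (sym (shiftMS-≰ F i s j s≰F)) 𝓖F) , refl)) s≰F

  -- Whether the shifted multiset is already in 𝓖 is undecidable, hence the double negation.
  shifts-nonempty : ∀ js 𝓖 F → 𝓖 F → ¬ ¬ ∃ (shifts js 𝓖)
  shifts-nonempty [] 𝓖 F 𝓖F empty = empty (F , 𝓖F)
  shifts-nonempty (j ∷ js) 𝓖 F 𝓖F empty = shiftFam-nonempty λ (G , G∈) → shifts-nonempty js _ G G∈ empty
    where
    shiftFam-nonempty : ¬ ¬ ∃ (shiftFam i s j 𝓖)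
    shiftFam-nonempty none with 1 ≤? mult j F
    ... | yes j∈F = none (F , F , 𝓖F , inj₁ (inj₁ j∈F , refl))
    ... | no j∉F = none (shiftMS F i s j , F , 𝓖F ,
                         inj₂ ((j∉F , λ moved∈𝓖 → none (F , F , 𝓖F , inj₁ (inj₂ moved∈𝓖 , refl))) , refl))

  -- A member K moved by the j-th shift has s ≤ m(i,K); if K survives all shifts it
  -- survives the j-th one unmoved, so its move was blocked after all.
  shifts-⊆ : ∀ js 𝓖 → (∀ K → 𝓖 K → s ≤ mult i K → shifts js 𝓖 K) → ∀ H → shifts js 𝓖 H → 𝓖 H
  shifts-⊆ [] 𝓖 _ H H∈ = H∈
  shifts-⊆ (j ∷ js) 𝓖 big-survive H H∈ = unshift (shifts-⊆ js (shiftFam i s j 𝓖) big-survive′ H H∈)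
    where
    big-survive′ : ∀ K → shiftFam i s j 𝓖 K → s ≤ mult i K → shifts js (shiftFam i s j 𝓖) K
    big-survive′ K K∈ s≤K = big-survive K (proj₁ (shiftFam-unmoved K∈ (s≤⇒≢s∸1 s≤K))) s≤K
    unshift : shiftFam i s j 𝓖 H → 𝓖 H
    unshift (K , 𝓖K , inj₁ (_ , refl)) = 𝓖K
    unshift (K , 𝓖K , inj₂ ((j∉K , moved∉𝓖) , refl)) with s ≤? mult i K
    ... | no s≰K = ⊥-elim (moved∉𝓖 (subst 𝓖 (sym (shiftMS-≰ K i s j s≰K)) 𝓖K))
    ... | yes s≤K = ⊥-elim ([ j∉K , moved∉𝓖 ]′ (proj₂ (shiftFam-unmoved K∈ (s≤⇒≢s∸1 s≤K))))
      where
      K∈ : shiftFam i s j 𝓖 K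
      K∈ = shifts-unmoved js _ K (big-survive K 𝓖K s≤K) (s≤⇒≢s∸1 s≤K)

  shifts⇔⇒⇔ : ∀ js 𝓖 (𝓟 : Family m) → (∀ G → shifts js 𝓖 G ⇔ 𝓟 G) → (∀ F → 𝓖 F → 𝓟 F) → ∀ G → 𝓖 G ⇔ 𝓟 G
  shifts⇔⇒⇔ js 𝓖 𝓟 shifts⇔𝓟 𝓖⊆𝓟 G = mk⇔ (𝓖⊆𝓟 G) (shifts-⊆ js 𝓖 big-survive G ∘ from)
    where
    from : ∀ {H} → 𝓟 H → shifts js 𝓖 H
    from = Equivalence.from (shifts⇔𝓟 _)
    big-survive : ∀ K → 𝓖 K → s ≤ mult i K → shifts js 𝓖 K
    big-survive K 𝓖K _ = from (𝓖⊆𝓟 K 𝓖K)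

t+2r≤2k∸t : ∀ {k} t r → t + r ≤ k → t + 2 * r ≤ 2 * k ∸ t
t+2r≤2k∸t {k} t r t+r≤k = begin
  t + 2 * r            ≡⟨ m+n∸n≡m (t + 2 * r) t ⟨
  t + 2 * r + t ∸ t    ≡⟨ cong (_∸ t) (regroup t r) ⟩
  2 * (t + r) ∸ t      ≤⟨ ∸-monoˡ-≤ t (*-monoʳ-≤ 2 t+r≤k) ⟩
  2 * k ∸ t            ∎
  where
  open ≤-Reasoning
  regroup : ∀ t r → t + 2 * r + t ≡ 2 * (t + r)
  regroup = solve-∀

t-intersecting⊆famR : ∀ {m k t r} → 1 ≤ t → 2 * k ∸ t ≤ m → 0 < r →
  (𝓕 : Family m) → IsKFamily k 𝓕 → IsTIntersecting t 𝓕 → (i : Fin m) {s : ℕ} → 2 ≤ s →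
  (σ : Permutation′ m) → (∀ G → shiftAll i s 𝓕 G ⇔ famR m k t r (permute σ G)) →
  ∀ F → 𝓕 F → famR m k t r (permute σ F)
t-intersecting⊆famR {m} {k} {t} {r} 1≤t 2k∸t≤m 0<r 𝓕 k-uniform intersecting i {s} 2≤s σ 𝓕̂⇔P F 𝓕F =
  decidable-stable (famR? k t r (permute σ F)) outside-impossible
  where
  open Shifting i s (≤-trans (n≤1+n 1) 2≤s)

  to : ∀ {G} → shiftAll i s 𝓕 G → famR m k t r (permute σ G)
  to = Equivalence.to (𝓕̂⇔P _)

  from : ∀ {G} → famR m k t r (permute σ G) → shiftAll i s 𝓕 G
  from = Equivalence.from (𝓕̂⇔P _)

  outside-impossible : ¬ famR m k t r (permute σ F) → ⊥
  outside-impossible σF∉ with s ≤? mult i F | t + r ≤? k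
  ... | no s≰F | _ = σF∉ (to (shifts-keep-≱ (allFin m) 𝓕 F 𝓕F s≰F))
  ... | yes _ | no t+r≰k =
    shifts-nonempty (allFin m) 𝓕 F 𝓕F λ (G , G∈) → t+r≰k (famR⇒t+r≤k k t r (permute σ G) (to G∈))
  ... | yes s≤F | yes t+r≤k =
    let H , σH∈ , iH≡0 , F∩H<t = famR∘permute-avoiding σ F i 1≤t 0<r t+r≤k
          (≤-trans (t+2r≤2k∸t t r t+r≤k) 2k∸t≤m) (k-uniform F 𝓕F) σF∉ (≤-trans (≤-trans (n≤1+n 1) 2≤s) s≤F)
        𝓕H = shifts-unmoved (allFin m) 𝓕 H (from σH∈)
               λ iH≡s∸1 → <⇒≢ (m<n⇒0<n∸m 2≤s) (trans (sym iH≡0) iH≡s∸1)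
    in <⇒≱ F∩H<t (intersecting F H 𝓕F 𝓕H)

lemma4p6 : (m k t : ℕ) → 1 ≤ t → t ≤ k → 2 * k ∸ t ≤ m →
    (𝓕 : Family m) → IsKFamily k 𝓕 → IsTIntersecting t 𝓕 →
    (T : MSet m) → InK t 𝓕 T →
    (i : Fin m) → 2 ≤ mult i T →
    (r : ℕ) → 0 < r →
    Isomorphic (shiftAll i (mult i T) 𝓕) (famR m k t r) →
    Isomorphic 𝓕 (famR m k t r)
-- The kernel T matters only through s = m(i,T) ≥ 2.
lemma4p6 m k t 1≤t _ 2k∸t≤m 𝓕 k-uniform intersecting T _ i 2≤s r 0<r (σ , 𝓕̂⇔P) =
  σ , shifts⇔⇒⇔ (allFin m) 𝓕 _ 𝓕̂⇔P (t-intersecting⊆famR 1≤t 2k∸t≤m 0<r 𝓕 k-uniform intersecting i 2≤s σ 𝓕̂⇔P)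
  where open Shifting i (mult i T) (≤-trans (n≤1+n 1) 2≤s)
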